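{- Let $n\ge 11$ be odd and $T_{n,3}=\frac{n(n+1)}{2}-3$. Then $\#\mathbb U^*_{T_{n,3}}=1$.
   Context: A partition of $N$ into distinct parts is a sequence of positive integers $\lambda_1<\dots<\lambda_t$ summing to $N$ with $t\ge 2$. Its missing parts are the elements of $\{1,\dots,\lambda_t\}\setminus\{\lambda_1,\dots,\lambda_t\}$. $\lambda$ is refinable if two distinct missing parts sum to a part of $\lambda$, unrefinable otherwise; $\mathbb U_N$ is the set of unrefinable partitions of $N$. $\mathbb U^*_N$ is the set of $\lambda\in\mathbb U_N$ whose largest part is the maximum of the largest parts over all of $\mathbb U_N$. Standing assumption: $n\ge 11$. -}

module Defs where

open import Data.Nat using (ℕ; _+_; _*_; _∸_; _≤_; _<_; _⊔_; _/_)
open import Data.List using (List; length; foldr)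
open import Data.Nat.ListAction using (sum)
open import Data.List.Relation.Unary.All using (All)
open import Data.List.Relation.Unary.Linked using (Linked)
open import Data.List.Membership.Propositional using (_∈_; _∉_)
open import Data.Product using (Σ; ∃; ∃-syntax; _×_)
open import Relation.Nullary using (¬_)
open import Relation.Binary.PropositionalEquality using (_≡_; _≢_)

-- A partition into distinct parts is represented by the strictly increasing
-- list of its parts  λ₁ < … < λₜ.
IsDistinctPartition : ℕ → List ℕ → Set
IsDistinctPartition N λs =
  Linked _<_ λs × All (1 ≤_) λs × sum λs ≡ N × 2 ≤ length λs

largest : List ℕ → ℕ
largest = foldr _⊔_ 0

Missing : List ℕ → ℕ → Set
Missing λs m = 1 ≤ m × m ≤ largest λs × m ∉ λs

Refinable : List ℕ → Set
Refinable λs = ∃[ a ] ∃[ b ] (a ≢ b × Missing λs a × Missing λs b × (a + b) ∈ λs)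

InU : ℕ → List ℕ → Set
InU N λs = IsDistinctPartition N λs × ¬ Refinable λs

InUStar : ℕ → List ℕ → Set
InUStar N λs = InU N λs × (∀ μs → InU N μs → largest μs ≤ largest λs)

UStarHasExactlyOne : ℕ → Set
UStarHasExactlyOne N = ∃[ λs ] (InUStar N λs × (∀ μs → InUStar N μs → μs ≡ λs))

T : ℕ → ℕ → ℕ
T n k = (n * (n + 1)) / 2 ∸ k

module Submission where

-- If λ is unrefinable with largest part L and a + a < L, then a and L − a cannot both be
-- missing, since they would refine L. Peeling off these pairs for a = 1, …, r shows that
-- the parts sum to L + (1 + ⋯ + r) + excess + (the remaining parts), where each pair adds
-- 0, L − 2a or L − a to the excess. Put c = n − 2, so that T_{n,3} = 2c + c(c + 1)/2.
-- A largest part L > 2c would allow r = c and force a sum above T_{n,3}, while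
-- (1, 2, …, c, 2c) is unrefinable; so the maximal largest part is 2c. For L = 2c and
-- r = c − 1 the slack is exactly c, split between the excess and the parts outside all
-- pairs, which can only be c. Every pair contribution is even or at least c + 1, and c
-- is odd, so the excess is 0 and c is a part: λ = (1, 2, …, c, 2c).

open import Defs
open import Data.Nat using (ℕ; zero; suc; _+_; _*_; _∸_; _≤_; _<_; _/_; _%_; z≤n; s≤s; _≟_; _≤?_)
open import Data.Nat.Properties
open import Data.Nat.Divisibility using (_∣_; _∣0; divides; ∣m∣n⇒∣m+n; ∣m+n∣m⇒∣n; n∣m⇒m%n≡0)
open import Data.Nat.DivMod using (m*n/n≡m)
open import Data.Nat.ListAction using (sum)
open import Data.Nat.ListAction.Properties using (sum-++)
open import Data.List using (List; []; _∷_; _++_; _∷ʳ_; length; filter; applyUpTo)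
open import Data.List.Properties
  using (filter-all; filter-accept; filter-reject; length-++; length-applyUpTo; applyUpTo-∷ʳ)
open import Data.List.Relation.Unary.All as All using (All; []; _∷_)
import Data.List.Relation.Unary.All.Properties as All
open import Data.List.Relation.Unary.Any using (here; there)
open import Data.List.Relation.Unary.Linked as Linked using (Linked; [-]; _∷_)
open import Data.List.Relation.Binary.Subset.Propositional using (_⊆_)
open import Data.List.Relation.Unary.Linked.Properties using (Linked⇒All; Linked⇒AllPairs; AllPairs⇒Linked)
open import Data.List.Relation.Unary.AllPairs as AllPairs using ([]; _∷_)
import Data.List.Relation.Unary.AllPairs.Properties as AllPairs
open import Data.List.Relation.Unary.Unique.Propositional using (Unique)
import Data.List.Relation.Unary.Unique.Propositional.Properties as Unique
open import Data.List.Membership.Propositional using (_∈_; _∉_)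
open import Data.List.Membership.Propositional.Properties
  using (∈-filter⁺; ∈-filter⁻; ∈-++⁺ˡ; ∈-++⁺ʳ; ∈-++⁻; ∈-applyUpTo⁺; ∈-applyUpTo⁻)
open import Data.List.Membership.DecPropositional _≟_ using (_∈?_)
open import Data.Product using (_×_; _,_; proj₁; proj₂)
open import Data.Sum as Sum using (_⊎_; inj₁; inj₂; [_,_]′)
open import Function using (id; _∘′_)
open import Relation.Nullary using (¬_; Dec; yes; no; ¬?; contradiction)
open import Relation.Binary.PropositionalEquality
open import Relation.Binary.Definitions using (tri<; tri≈; tri>)
open import Data.Nat.Tactic.RingSolver using (solve-∀)

Linked<⇒Unique : ∀ {xs} → Linked _<_ xs → Unique xs
Linked<⇒Unique = AllPairs.map <⇒≢ ∘′ Linked⇒AllPairs <-trans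

Linked<-head : ∀ {x xs} → Linked _<_ (x ∷ xs) → All (x <_) xs
Linked<-head [-]         = []
Linked<-head (x<y ∷ lk) = Linked⇒All <-trans x<y lk

Linked<-⊆-antisym : ∀ {xs ys} → Linked _<_ xs → Linked _<_ ys → xs ⊆ ys → ys ⊆ xs → xs ≡ ys
Linked<-⊆-antisym {[]}     {[]}     _  _  _     _     = refl
Linked<-⊆-antisym {[]}     {y ∷ ys} _  _  _     ys⊆xs with () ← ys⊆xs (here refl)
Linked<-⊆-antisym {x ∷ xs} {[]}     _  _  xs⊆ys _     with () ← xs⊆ys (here refl)
Linked<-⊆-antisym {x ∷ xs} {y ∷ ys} lx ly xs⊆ys ys⊆xs =
  cong₂ _∷_ x≡y (Linked<-⊆-antisym (Linked.tail lx) (Linked.tail ly)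
                                   (shrink lx ly x≡y xs⊆ys) (shrink ly lx (sym x≡y) ys⊆xs))
  where
  x≡y : x ≡ y
  x≡y with xs⊆ys (here refl) | ys⊆xs (here refl)
  ... | here x≡y   | _          = x≡y
  ... | there _    | here y≡x   = sym y≡x
  ... | there x∈ys | there y∈xs =
    contradiction (All.lookup (Linked<-head ly) x∈ys) (<-asym (All.lookup (Linked<-head lx) y∈xs))
  shrink : ∀ {u us v vs} → Linked _<_ (u ∷ us) → Linked _<_ (v ∷ vs) → u ≡ v → u ∷ us ⊆ v ∷ vs → us ⊆ vs
  shrink lu lv refl us⊆vs z∈us with us⊆vs (there z∈us)
  ... | here refl  = contradiction (All.lookup (Linked<-head lu) z∈us) (<-irrefl refl)
  ... | there z∈vs = z∈vs

∈⇒≤largest : ∀ {x xs} → x ∈ xs → x ≤ largest xs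
∈⇒≤largest {xs = y ∷ ys} (here refl) = m≤m⊔n y (largest ys)
∈⇒≤largest {xs = y ∷ ys} (there x∈ys) = ≤-trans (∈⇒≤largest x∈ys) (m≤n⊔m y (largest ys))

largest≤ : ∀ {m xs} → All (_≤ m) xs → largest xs ≤ m
largest≤ []           = z≤n
largest≤ (x≤m ∷ xs≤m) = ⊔-lub x≤m (largest≤ xs≤m)

largest∈ : ∀ {xs} → 0 < largest xs → largest xs ∈ xs
largest∈ {x ∷ xs} 0<max with ⊔-sel x (largest xs)
... | inj₁ eq = here eq
... | inj₂ eq = there (subst (_∈ xs) (sym eq) (largest∈ (subst (0 <_) eq 0<max)))

_≢?_ : (y x : ℕ) → Dec (y ≢ x)
y ≢? x = ¬? (y ≟ x)

remove : ℕ → List ℕ → List ℕ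
remove x = filter (_≢? x)

∈-remove⁺ : ∀ {x y xs} → y ∈ xs → y ≢ x → y ∈ remove x xs
∈-remove⁺ = ∈-filter⁺ _

∈-remove⁻ : ∀ {x y xs} → y ∈ remove x xs → y ∈ xs × y ≢ x
∈-remove⁻ = ∈-filter⁻ _

remove⊆ : ∀ {x xs} → remove x xs ⊆ xs
remove⊆ = proj₁ ∘′ ∈-remove⁻

Unique-remove : ∀ {x xs} → Unique xs → Unique (remove x xs)
Unique-remove = Unique.filter⁺ _

remove-∉ : ∀ {x xs} → x ∉ xs → remove x xs ≡ xs
remove-∉ x∉xs = filter-all _ (All.map (_∘′ sym) (All.¬Any⇒All¬ _ x∉xs))

sum-remove : ∀ {x xs} → Unique xs → x ∈ xs → sum xs ≡ x + sum (remove x xs)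
sum-remove {x} {y ∷ ys} (y∉ys ∷ u) x∈ with y ≟ x
... | yes refl = cong (y +_) (begin
  sum ys                ≡⟨ cong sum (remove-∉ (All.All¬⇒¬Any y∉ys)) ⟨
  sum (remove y ys)     ≡⟨ cong sum (filter-reject (_≢? y) (λ y≢y → y≢y refl)) ⟨
  sum (remove y (y ∷ ys)) ∎)
  where open ≡-Reasoning
... | no y≢x with x∈
...   | here x≡y   = contradiction (sym x≡y) y≢x
...   | there x∈ys = begin
  y + sum ys                      ≡⟨ cong (y +_) (sum-remove u x∈ys) ⟩
  y + (x + sum (remove x ys))     ≡⟨ +-exchange y x _ ⟩
  x + (y + sum (remove x ys))     ≡⟨ cong (λ zs → x + sum zs) (filter-accept (_≢? x) y≢x) ⟨
  x + sum (remove x (y ∷ ys))     ∎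
  where
  open ≡-Reasoning
  +-exchange : ∀ a b c → a + (b + c) ≡ b + (a + c)
  +-exchange = solve-∀

triangular : ℕ → ℕ
triangular zero    = 0
triangular (suc n) = suc n + triangular n

triangular*2 : ∀ n → triangular n * 2 ≡ n * suc n
triangular*2 zero    = refl
triangular*2 (suc n) = begin
  (suc n + triangular n) * 2      ≡⟨ *-distribʳ-+ 2 (suc n) (triangular n) ⟩
  suc n * 2 + triangular n * 2    ≡⟨ cong (suc n * 2 +_) (triangular*2 n) ⟩
  suc n * 2 + n * suc n           ≡⟨ expand n ⟩
  suc n * suc (suc n)             ∎
  where
  open ≡-Reasoning
  expand : ∀ n → suc n * 2 + n * suc n ≡ suc n * suc (suc n)
  expand = solve-∀

2∣n+n : ∀ n → 2 ∣ n + n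
2∣n+n n = divides n (n+n≡n*2 n)
  where
  n+n≡n*2 : ∀ n → n + n ≡ n * 2
  n+n≡n*2 = solve-∀

EvenOrAtLeast : ℕ → ℕ → ℕ → Set
EvenOrAtLeast L B x = (2 ∣ L → 2 ∣ x) ⊎ B ≤ x

EvenOrAtLeast-+ : ∀ {L B x y} → EvenOrAtLeast L B x → EvenOrAtLeast L B y → EvenOrAtLeast L B (x + y)
EvenOrAtLeast-+ (inj₁ x-even) (inj₁ y-even) = inj₁ λ 2∣L → ∣m∣n⇒∣m+n (x-even 2∣L) (y-even 2∣L)
EvenOrAtLeast-+ {x = x} {y} (inj₂ B≤x) _     = inj₂ (≤-trans B≤x (m≤m+n x y))
EvenOrAtLeast-+ {x = x} {y} _ (inj₂ B≤y)     = inj₂ (≤-trans B≤y (m≤n+m y x))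

EvenOrAtLeast-weaken : ∀ {L B B′ x} → B′ ≤ B → EvenOrAtLeast L B x → EvenOrAtLeast L B′ x
EvenOrAtLeast-weaken B′≤B = Sum.map₂ (≤-trans B′≤B)

record PairRemoval (a b : ℕ) (xs : List ℕ) : Set where
  field
    surplus               : ℕ
    sum-≡                 : sum xs ≡ a + surplus + sum (remove b (remove a xs))
    surplus-evenOrAtLeast : EvenOrAtLeast (a + b) b surplus
    surplus≡0⇒b∉          : surplus ≡ 0 → b ∉ xs

removePair : ∀ {a b xs} → a < b → Unique xs → a ∈ xs ⊎ b ∈ xs → PairRemoval a b xs
removePair {a} {b} {xs} a<b u covered with a ∈? xs | b ∈? xs
... | yes a∈xs | yes b∈xs = record
  { surplus               = b
  ; sum-≡                 = begin
      sum xs                                 ≡⟨ sum-remove u a∈xs ⟩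
      a + sum (remove a xs)                  ≡⟨ cong (a +_) (sum-remove (Unique-remove u) b∈xs∖a) ⟩
      a + (b + sum (remove b (remove a xs))) ≡⟨ +-assoc a b _ ⟨
      a + b + sum (remove b (remove a xs))   ∎
  ; surplus-evenOrAtLeast = inj₂ ≤-refl
  ; surplus≡0⇒b∉          = λ b≡0 → contradiction (subst (a <_) b≡0 a<b) λ ()
  }
  where
  open ≡-Reasoning
  b∈xs∖a : b ∈ remove a xs
  b∈xs∖a = ∈-remove⁺ b∈xs (>⇒≢ a<b)
... | yes a∈xs | no b∉xs = record
  { surplus               = 0
  ; sum-≡                 = begin
      sum xs                                 ≡⟨ sum-remove u a∈xs ⟩
      a + sum (remove a xs)                  ≡⟨ cong (λ zs → a + sum zs) (remove-∉ (b∉xs ∘′ remove⊆)) ⟨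
      a + sum (remove b (remove a xs))       ≡⟨ cong (_+ sum (remove b (remove a xs))) (+-identityʳ a) ⟨
      a + 0 + sum (remove b (remove a xs))   ∎
  ; surplus-evenOrAtLeast = inj₁ λ _ → 2 ∣0
  ; surplus≡0⇒b∉          = λ _ → b∉xs
  }
  where open ≡-Reasoning
... | no a∉xs | yes b∈xs = record
  { surplus               = b ∸ a
  ; sum-≡                 = begin
      sum xs                                   ≡⟨ sum-remove u b∈xs ⟩
      b + sum (remove b xs)
        ≡⟨ cong₂ (λ n zs → n + sum (remove b zs)) a+[b∸a]≡b (remove-∉ a∉xs) ⟨
      a + (b ∸ a) + sum (remove b (remove a xs)) ∎
  ; surplus-evenOrAtLeast = inj₁ λ 2∣a+b → ∣m+n∣m⇒∣n (subst (2 ∣_) a+b≡a+a+[b∸a] 2∣a+b) (2∣n+n a)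
  ; surplus≡0⇒b∉          = λ b∸a≡0 → contradiction b∸a≡0 (>⇒≢ (m<n⇒0<n∸m a<b))
  }
  where
  open ≡-Reasoning
  a+[b∸a]≡b : a + (b ∸ a) ≡ b
  a+[b∸a]≡b = m+[n∸m]≡n (<⇒≤ a<b)
  a+b≡a+a+[b∸a] : a + b ≡ a + a + (b ∸ a)
  a+b≡a+a+[b∸a] = trans (cong (a +_) (sym a+[b∸a]≡b)) (sym (+-assoc a a (b ∸ a)))
... | no a∉xs | no b∉xs = contradiction covered [ a∉xs , b∉xs ]′

PairCovered : ℕ → ℕ → List ℕ → Set
PairCovered L r xs = ∀ a → 1 ≤ a → a ≤ r → a ∈ xs ⊎ L ∸ a ∈ xs

InNoPair : ℕ → ℕ → ℕ → Set
InNoPair L r x = ∀ a → 1 ≤ a → a ≤ r → x ≢ a × x ≢ L ∸ a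

record Decomposition (L r : ℕ) (xs : List ℕ) : Set where
  field
    rest                 : List ℕ
    excess               : ℕ
    sum-≡                : sum xs ≡ L + triangular r + excess + sum rest
    rest⊆                : rest ⊆ xs
    rest-unpaired        : ∀ {x} → x ∈ rest → x ≢ L × InNoPair L r x
    excess-evenOrAtLeast : EvenOrAtLeast L (L ∸ r) excess
    excess≡0⇒partners∉   : excess ≡ 0 → ∀ a → 1 ≤ a → a ≤ r → L ∸ a ∉ xs

<∸-self : ∀ {a L} → a + a < L → a < L ∸ a
<∸-self {a} = m+n≤o⇒m≤o∸n (suc a)

∈-remove₂⁺ : ∀ {a b y xs} → y ∈ xs → y ≢ a → y ≢ b → y ∈ remove b (remove a xs)
∈-remove₂⁺ y∈xs y≢a y≢b = ∈-remove⁺ (∈-remove⁺ y∈xs y≢a) y≢b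

∈-remove₂⁻ : ∀ {a b y xs} → y ∈ remove b (remove a xs) → y ≢ a × y ≢ b
∈-remove₂⁻ {a} {b} {y} {xs} y∈ with y∈xs′ , y≢b ← ∈-remove⁻ {b} {y} {remove a xs} y∈ =
  proj₂ (∈-remove⁻ {a} {y} {xs} y∈xs′) , y≢b

decompose₀ : ∀ {L xs} → Unique xs → L ∈ xs → Decomposition L 0 xs
decompose₀ {L} {xs} u L∈xs = record
  { rest                 = remove L xs
  ; excess               = 0
  ; sum-≡                = trans (sum-remove u L∈xs) (cong (_+ sum (remove L xs)) (sym L+0+0≡L))
  ; rest⊆                = remove⊆ {L} {xs}
  ; rest-unpaired        = λ x∈ → proj₂ (∈-remove⁻ {L} {_} {xs} x∈) ,
                                  λ a 1≤a a≤0 → contradiction (≤-trans 1≤a a≤0) 1≰0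
  ; excess-evenOrAtLeast = inj₁ λ _ → 2 ∣0
  ; excess≡0⇒partners∉   = λ _ a 1≤a a≤0 → contradiction (≤-trans 1≤a a≤0) 1≰0
  }
  where
  L+0+0≡L : L + 0 + 0 ≡ L
  L+0+0≡L = trans (+-identityʳ (L + 0)) (+-identityʳ L)
  1≰0 : ¬ 1 ≤ 0
  1≰0 ()

InNoPair-suc : ∀ {L r x} → InNoPair L r x → x ≢ suc r → x ≢ L ∸ suc r → InNoPair L (suc r) x
InNoPair-suc none x≢a x≢b a 1≤a a≤1+r with m≤n⇒m<n∨m≡n a≤1+r
... | inj₁ a<1+r = none a 1≤a (m<1+n⇒m≤n a<1+r)
... | inj₂ refl  = x≢a , x≢b

extendDecomposition : ∀ {L r xs} → suc r + suc r < L →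
  PairRemoval (suc r) (L ∸ suc r) xs → Decomposition L r (remove (L ∸ suc r) (remove (suc r) xs)) →
  Decomposition L (suc r) xs
extendDecomposition {L} {r} {xs} lt pr D = record
  { rest                 = rest
  ; excess               = excess + surplus
  ; sum-≡                = begin
      sum xs                                                 ≡⟨ PairRemoval.sum-≡ pr ⟩
      a + surplus + sum xs′                                  ≡⟨ cong (a + surplus +_) (Decomposition.sum-≡ D) ⟩
      a + surplus + (L + triangular r + excess + sum rest)   ≡⟨ regroup a surplus L (triangular r) excess _ ⟩
      L + (a + triangular r) + (excess + surplus) + sum rest ∎
  ; rest⊆                = remove⊆ {a} {xs} ∘′ remove⊆ {b} {remove a xs} ∘′ rest⊆
  ; rest-unpaired        = λ x∈ → let x≢L , none = rest-unpaired x∈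
                                      x≢a , x≢b  = ∈-remove₂⁻ {a} {b} {_} {xs} (rest⊆ x∈)
                                  in x≢L , InNoPair-suc none x≢a x≢b
  ; excess-evenOrAtLeast = EvenOrAtLeast-+
      (EvenOrAtLeast-weaken (∸-monoʳ-≤ L (n≤1+n r)) excess-evenOrAtLeast)
      (subst (λ M → EvenOrAtLeast M b surplus) (m+[n∸m]≡n a≤L) surplus-evenOrAtLeast)
  ; excess≡0⇒partners∉   = partners∉
  }
  where
  open ≡-Reasoning
  open PairRemoval pr using (surplus; surplus-evenOrAtLeast; surplus≡0⇒b∉)
  open Decomposition D using (rest; excess; rest⊆; rest-unpaired; excess-evenOrAtLeast; excess≡0⇒partners∉)
  a b : ℕ
  a = suc r
  b = L ∸ suc r
  xs′ : List ℕ
  xs′ = remove b (remove a xs)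
  a<b : a < b
  a<b = <∸-self lt
  a≤L : a ≤ L
  a≤L = ≤-trans (m≤m+n a a) (<⇒≤ lt)
  regroup : ∀ a s L t e z → a + s + (L + t + e + z) ≡ L + (a + t) + (e + s) + z
  regroup = solve-∀
  partners∉ : excess + surplus ≡ 0 → ∀ a′ → 1 ≤ a′ → a′ ≤ suc r → L ∸ a′ ∉ xs
  partners∉ e+s≡0 a′ 1≤a′ a′≤a p∈xs with m≤n⇒m<n∨m≡n a′≤a
  ... | inj₂ refl = surplus≡0⇒b∉ (m+n≡0⇒n≡0 excess e+s≡0) p∈xs
  ... | inj₁ a′<a = excess≡0⇒partners∉ (m+n≡0⇒m≡0 excess e+s≡0) a′ 1≤a′ (m<1+n⇒m≤n a′<a)
                      (∈-remove₂⁺ p∈xs (>⇒≢ (<-trans a<b b<p)) (>⇒≢ b<p))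
    where
    b<p : b < L ∸ a′
    b<p = ∸-monoʳ-< a′<a a≤L

decompose : ∀ {L xs} r → Unique xs → L ∈ xs → r + r < L → PairCovered L r xs → Decomposition L r xs
decompose zero u L∈xs _ _ = decompose₀ u L∈xs
decompose {L} {xs} (suc r) u L∈xs lt covered =
  extendDecomposition lt (removePair a<b u (covered a (s≤s z≤n) ≤-refl))
    (decompose r (Unique-remove (Unique-remove u)) L∈xs′ r+r<L covered′)
  where
  a b : ℕ
  a = suc r
  b = L ∸ a
  a<b : a < b
  a<b = <∸-self lt
  a≤L : a ≤ L
  a≤L = ≤-trans (m≤m+n a a) (<⇒≤ lt)
  b<L : b < L
  b<L = ∸-monoʳ-< {o = 0} (s≤s z≤n) a≤L
  L∈xs′ : L ∈ remove b (remove a xs)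
  L∈xs′ = ∈-remove₂⁺ L∈xs (>⇒≢ (<-trans a<b b<L)) (>⇒≢ b<L)
  r+r<L : r + r < L
  r+r<L = <-trans (+-mono-< (n<1+n r) (n<1+n r)) lt
  covered′ : PairCovered L r (remove b (remove a xs))
  covered′ a′ 1≤a′ a′≤r with covered a′ 1≤a′ (m≤n⇒m≤1+n a′≤r)
  ... | inj₁ a′∈xs = inj₁ (∈-remove₂⁺ a′∈xs (<⇒≢ a′<a) (<⇒≢ (<-trans a′<a a<b)))
    where a′<a = s≤s a′≤r
  ... | inj₂ p∈xs  = inj₂ (∈-remove₂⁺ p∈xs (>⇒≢ (<-trans a<b b<p)) (>⇒≢ b<p))
    where b<p = ∸-monoʳ-< (s≤s a′≤r) a≤L

unrefinable⇒pairCovered : ∀ {xs} r → ¬ Refinable xs → r + r < largest xs → PairCovered (largest xs) r xs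
unrefinable⇒pairCovered {xs} r unrefinable lt a 1≤a a≤r with a ∈? xs | largest xs ∸ a ∈? xs
... | yes a∈xs | _        = inj₁ a∈xs
... | no _     | yes p∈xs = inj₂ p∈xs
... | no a∉xs  | no p∉xs  = contradiction refinable unrefinable
  where
  L : ℕ
  L = largest xs
  a<p : a < L ∸ a
  a<p = <∸-self (≤-<-trans (+-mono-≤ a≤r a≤r) lt)
  a≤L : a ≤ L
  a≤L = ≤-trans (<⇒≤ a<p) (m∸n≤m L a)
  refinable : Refinable xs
  refinable = a , L ∸ a , <⇒≢ a<p , (1≤a , a≤L , a∉xs) , (≤-trans 1≤a (<⇒≤ a<p) , m∸n≤m L a , p∉xs) ,
              subst (_∈ xs) (sym (m+[n∸m]≡n a≤L)) (largest∈ (≤-<-trans z≤n lt))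

unrefinable-sum-bound : ∀ {N xs} r → InU N xs → r + r < largest xs → largest xs + triangular r ≤ N
unrefinable-sum-bound {N} {xs} r ((increasing , _ , sum≡N , _) , unrefinable) lt = begin
  largest xs + triangular r                                ≤⟨ m≤m+n _ _ ⟩
  largest xs + triangular r + excess                       ≤⟨ m≤m+n _ _ ⟩
  largest xs + triangular r + excess + sum rest            ≡⟨ sum-≡ ⟨
  sum xs                                                   ≡⟨ sum≡N ⟩
  N                                                        ∎
  where
  open ≤-Reasoning
  open Decomposition (decompose r (Linked<⇒Unique increasing) (largest∈ (≤-<-trans z≤n lt)) lt
                                  (unrefinable⇒pairCovered r unrefinable lt))

oneTo : ℕ → List ℕ
oneTo = applyUpTo suc

∈-oneTo⁺ : ∀ {c x} → 1 ≤ x → x ≤ c → x ∈ oneTo c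
∈-oneTo⁺ {x = suc i} _ i<c = ∈-applyUpTo⁺ suc i<c

∈-oneTo⁻ : ∀ {c x} → x ∈ oneTo c → 1 ≤ x × x ≤ c
∈-oneTo⁻ x∈ with _ , i<c , refl ← ∈-applyUpTo⁻ suc x∈ = s≤s z≤n , i<c

sum-oneTo : ∀ c → sum (oneTo c) ≡ triangular c
sum-oneTo zero    = refl
sum-oneTo (suc c) = begin
  sum (oneTo (suc c))              ≡⟨ cong sum (applyUpTo-∷ʳ suc c) ⟨
  sum (oneTo c ++ suc c ∷ [])      ≡⟨ sum-++ (oneTo c) (suc c ∷ []) ⟩
  sum (oneTo c) + (suc c + 0)      ≡⟨ cong₂ _+_ (sum-oneTo c) (+-identityʳ (suc c)) ⟩
  triangular c + suc c             ≡⟨ +-comm (triangular c) (suc c) ⟩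
  triangular (suc c)               ∎
  where open ≡-Reasoning

oneTo∷ʳ-increasing : ∀ {c L} → c < L → Linked _<_ (oneTo c ∷ʳ L)
oneTo∷ʳ-increasing {c} c<L = AllPairs⇒Linked (AllPairs.++⁺
  (AllPairs.applyUpTo⁺₁ suc c (λ i<j _ → s≤s i<j))
  ([] ∷ [])
  (All.applyUpTo⁺₁ suc c (λ i<c → ≤-<-trans i<c c<L ∷ [])))

largest-oneTo∷ʳ : ∀ {c L} → c ≤ L → largest (oneTo c ∷ʳ L) ≡ L
largest-oneTo∷ʳ {c} {L} c≤L = ≤-antisym
  (largest≤ (All.++⁺ (All.applyUpTo⁺₁ suc c (λ i<c → ≤-trans i<c c≤L)) (≤-refl ∷ [])))
  (∈⇒≤largest (∈-++⁺ʳ (oneTo c) (here refl)))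

module OddMiddle (r : ℕ) (c-odd : ¬ 2 ∣ suc r) where

  c : ℕ
  c = suc r

  L : ℕ
  L = c + c

  N : ℕ
  N = L + triangular c

  candidate : List ℕ
  candidate = oneTo c ∷ʳ L

  c<L : c < L
  c<L = m<m+n c (s≤s z≤n)

  r+r<L : r + r < L
  r+r<L = +-mono-< (n<1+n r) (n<1+n r)

  L∸r≡1+c : L ∸ r ≡ suc c
  L∸r≡1+c = trans (cong (_∸ r) (L≡1+c+r r)) (m+n∸n≡m (suc c) r)
    where
    L≡1+c+r : ∀ r → suc r + suc r ≡ suc (suc r) + r
    L≡1+c+r = solve-∀

  largest-candidate : largest candidate ≡ L
  largest-candidate = largest-oneTo∷ʳ (<⇒≤ c<L)

  ∈-candidate⁺ : ∀ {x} → 1 ≤ x → x ≤ c → x ∈ candidate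
  ∈-candidate⁺ 1≤x x≤c = ∈-++⁺ˡ (∈-oneTo⁺ 1≤x x≤c)

  L∈candidate : L ∈ candidate
  L∈candidate = ∈-++⁺ʳ (oneTo c) (here refl)

  ∈-candidate⁻ : ∀ {x} → x ∈ candidate → (1 ≤ x × x ≤ c) ⊎ x ≡ L
  ∈-candidate⁻ x∈ with ∈-++⁻ (oneTo c) x∈
  ... | inj₁ x∈oneTo    = inj₁ (∈-oneTo⁻ x∈oneTo)
  ... | inj₂ (here x≡L) = inj₂ x≡L

  upper-partner : ∀ {x} → c < x → x < L → 1 ≤ L ∸ x × L ∸ x ≤ r × L ∸ (L ∸ x) ≡ x
  upper-partner {x} c<x x<L =
    m<n⇒0<n∸m x<L , subst (L ∸ x ≤_) (m+n∸n≡m r c) (∸-monoʳ-≤ L c<x) , m∸[m∸n]≡n (<⇒≤ x<L)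

  candidate-InU : InU N candidate
  candidate-InU = (oneTo∷ʳ-increasing c<L , positive , sum-candidate , two≤length) , unrefinable
    where
    positive : All (1 ≤_) candidate
    positive = All.++⁺ (All.applyUpTo⁺₂ suc c (λ _ → s≤s z≤n)) (≤-trans (s≤s z≤n) (<⇒≤ c<L) ∷ [])
    sum-candidate : sum candidate ≡ N
    sum-candidate = begin
      sum (oneTo c ++ L ∷ [])  ≡⟨ sum-++ (oneTo c) (L ∷ []) ⟩
      sum (oneTo c) + (L + 0)  ≡⟨ cong₂ _+_ (sum-oneTo c) (+-identityʳ L) ⟩
      triangular c + L         ≡⟨ +-comm (triangular c) L ⟩
      N                        ∎
      where open ≡-Reasoning
    two≤length : 2 ≤ length candidate
    two≤length = subst (2 ≤_) (sym (trans (length-++ (oneTo c)) (cong (_+ 1) (length-applyUpTo suc c))))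
                       (s≤s (m≤n+m 1 r))
    above-c : ∀ {x} → 1 ≤ x → x ∉ candidate → c < x
    above-c 1≤x x∉ = ≰⇒> (λ x≤c → x∉ (∈-candidate⁺ 1≤x x≤c))
    unrefinable : ¬ Refinable candidate
    unrefinable (a , b , _ , (1≤a , _ , a∉) , (1≤b , _ , b∉) , a+b∈) =
      <⇒≱ (+-mono-< (above-c 1≤a a∉) (above-c 1≤b b∉)) (subst (a + b ≤_) largest-candidate (∈⇒≤largest a+b∈))

  largest≤L : ∀ {μs} → InU N μs → largest μs ≤ L
  largest≤L {μs} u = ≮⇒≥ λ L<M →
    <⇒≱ L<M (+-cancelʳ-≤ (triangular c) (largest μs) L (unrefinable-sum-bound c u L<M))

  candidate-InUStar : InUStar N candidate
  candidate-InUStar = candidate-InU , λ _ u → subst (_ ≤_) (sym largest-candidate) (largest≤L u)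

  largest≡L⇒L∈ : ∀ {μs} → largest μs ≡ L → L ∈ μs
  largest≡L⇒L∈ {μs} M≡L = subst (_∈ μs) M≡L (largest∈ (subst (0 <_) (sym M≡L) (≤-<-trans z≤n c<L)))

  unpaired⇒≡c : ∀ {x} → 1 ≤ x → x < L → InNoPair L r x → x ≡ c
  unpaired⇒≡c {x} 1≤x x<L none with <-cmp x c
  ... | tri< x<c _ _ = contradiction refl (proj₁ (none x 1≤x (m<1+n⇒m≤n x<c)))
  ... | tri≈ _ x≡c _ = x≡c
  ... | tri> _ _ c<x = let 1≤a , a≤r , p≡x = upper-partner c<x x<L
                       in contradiction (sym p≡x) (proj₂ (none (L ∸ x) 1≤a a≤r))

  odd-split : ∀ {e} rest → (∀ {x} → x ∈ rest → x ≡ c) → c ≡ e + sum rest → EvenOrAtLeast L (suc c) e →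
              e ≡ 0 × c ∈ rest
  odd-split {e} [] _ c≡e+0 e-evenOrAtLeast with trans c≡e+0 (+-identityʳ e) | e-evenOrAtLeast
  ... | refl | inj₁ c-even = contradiction (c-even (2∣n+n c)) c-odd
  ... | refl | inj₂ c<c    = contradiction c<c (<-irrefl refl)
  odd-split {e} (y ∷ []) all≡c c≡e+y+0 _ = e≡0 , here (sym y≡c)
    where
    y≡c : y ≡ c
    y≡c = all≡c (here refl)
    e≡0 : e ≡ 0
    e≡0 = +-cancelʳ-≡ c e 0 (sym (trans c≡e+y+0 (cong (e +_) (trans (+-identityʳ y) y≡c))))
  odd-split {e} (y ∷ z ∷ zs) all≡c c≡ _ = contradiction (subst (L ≤_) (sym c≡) L≤) (<⇒≱ c<L)
    where
    L≤ : L ≤ e + (y + (z + sum zs))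
    L≤ = ≤-trans (+-mono-≤ (≤-reflexive (sym (all≡c (here refl))))
                           (≤-trans (≤-reflexive (sym (all≡c (there (here refl))))) (m≤m+n z (sum zs))))
                 (m≤n+m _ e)

  pinned-down : ∀ {μs} → Linked _<_ μs → All (1 ≤_) μs → largest μs ≡ L → c ∈ μs → PairCovered L r μs →
                (∀ a → 1 ≤ a → a ≤ r → L ∸ a ∉ μs) → μs ≡ candidate
  pinned-down {μs} increasing positive M≡L c∈μs covered partners∉ =
    Linked<-⊆-antisym increasing (oneTo∷ʳ-increasing c<L) μs⊆candidate candidate⊆μs
    where
    L∈μs : L ∈ μs
    L∈μs = largest≡L⇒L∈ M≡L
    μs⊆candidate : μs ⊆ candidate
    μs⊆candidate {x} x∈μs with x ≤? c | x ≟ L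
    ... | yes x≤c | _        = ∈-candidate⁺ (All.lookup positive x∈μs) x≤c
    ... | no _    | yes refl = L∈candidate
    ... | no x≰c  | no x≢L   =
      let 1≤a , a≤r , p≡x = upper-partner (≰⇒> x≰c) (≤∧≢⇒< (subst (x ≤_) M≡L (∈⇒≤largest x∈μs)) x≢L)
      in contradiction (subst (_∈ μs) (sym p≡x) x∈μs) (partners∉ (L ∸ x) 1≤a a≤r)
    candidate⊆μs : candidate ⊆ μs
    candidate⊆μs x∈ with ∈-candidate⁻ x∈
    ... | inj₂ refl = L∈μs
    ... | inj₁ (1≤x , x≤c) with m≤n⇒m<n∨m≡n x≤c
    ...   | inj₂ refl = c∈μs
    ...   | inj₁ x<c  = [ id , (λ p∈μs → contradiction p∈μs (partners∉ _ 1≤x (m<1+n⇒m≤n x<c))) ]′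
                          (covered _ 1≤x (m<1+n⇒m≤n x<c))

  InUStar⇒≡candidate : ∀ {μs} → InUStar N μs → μs ≡ candidate
  InUStar⇒≡candidate {μs} (u@((increasing , positive , sum≡N , _) , unrefinable) , maximal) =
    pinned-down increasing positive M≡L (rest⊆ c∈rest) covered (excess≡0⇒partners∉ e≡0)
    where
    M≡L : largest μs ≡ L
    M≡L = ≤-antisym (largest≤L u) (subst (_≤ largest μs) largest-candidate (maximal candidate candidate-InU))
    L∈μs : L ∈ μs
    L∈μs = largest≡L⇒L∈ M≡L
    covered : PairCovered L r μs
    covered = subst (λ M → PairCovered M r μs) M≡L
                (unrefinable⇒pairCovered r unrefinable (subst (r + r <_) (sym M≡L) r+r<L))
    open Decomposition (decompose r (Linked<⇒Unique increasing) L∈μs r+r<L covered)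
    c≡excess+rest : c ≡ excess + sum rest
    c≡excess+rest = +-cancelˡ-≡ (L + triangular r) c (excess + sum rest) (begin
      L + triangular r + c                   ≡⟨ regroup L c (triangular r) ⟩
      N                                      ≡⟨ trans (sym sum≡N) sum-≡ ⟩
      L + triangular r + excess + sum rest   ≡⟨ +-assoc (L + triangular r) excess (sum rest) ⟩
      L + triangular r + (excess + sum rest) ∎)
      where
      open ≡-Reasoning
      regroup : ∀ L c t → L + t + c ≡ L + (c + t)
      regroup = solve-∀
    rest≡c : ∀ {x} → x ∈ rest → x ≡ c
    rest≡c x∈ = let x∈μs = rest⊆ x∈ ; x≢L , none = rest-unpaired x∈ in
      unpaired⇒≡c (All.lookup positive x∈μs) (≤∧≢⇒< (subst (_ ≤_) M≡L (∈⇒≤largest x∈μs)) x≢L) none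
    e≡0×c∈rest : excess ≡ 0 × c ∈ rest
    e≡0×c∈rest = odd-split rest rest≡c c≡excess+rest
      (subst (λ B → EvenOrAtLeast L B excess) L∸r≡1+c excess-evenOrAtLeast)
    e≡0 : excess ≡ 0
    e≡0 = proj₁ e≡0×c∈rest
    c∈rest : c ∈ rest
    c∈rest = proj₂ e≡0×c∈rest

  UStar-singleton : UStarHasExactlyOne N
  UStar-singleton = candidate , candidate-InUStar , λ _ → InUStar⇒≡candidate

T-shifted : ∀ c → T (2 + c) 3 ≡ c + c + triangular c
T-shifted c = begin
  (2 + c) * (2 + c + 1) / 2 ∸ 3                ≡⟨ cong (λ m → m / 2 ∸ 3) product≡ ⟨
  (c + c + triangular c + 3) * 2 / 2 ∸ 3       ≡⟨ cong (_∸ 3) (m*n/n≡m (c + c + triangular c + 3) 2) ⟩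
  c + c + triangular c + 3 ∸ 3                 ≡⟨ m+n∸n≡m (c + c + triangular c) 3 ⟩
  c + c + triangular c                         ∎
  where
  open ≡-Reasoning
  product≡ : (c + c + triangular c + 3) * 2 ≡ (2 + c) * (2 + c + 1)
  product≡ = begin
    (c + c + triangular c + 3) * 2             ≡⟨ split c (triangular c) ⟩
    (c + c + 3) * 2 + triangular c * 2         ≡⟨ cong ((c + c + 3) * 2 +_) (triangular*2 c) ⟩
    (c + c + 3) * 2 + c * suc c                ≡⟨ expand c ⟩
    (2 + c) * (2 + c + 1)                      ∎
    where
    split : ∀ c t → (c + c + t + 3) * 2 ≡ (c + c + 3) * 2 + t * 2
    split = solve-∀
    expand : ∀ c → (c + c + 3) * 2 + c * suc c ≡ (2 + c) * (2 + c + 1)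
    expand = solve-∀

corollary2p12 : (n : ℕ) → 11 ≤ n → n % 2 ≡ 1 → UStarHasExactlyOne (T n 3)
corollary2p12 (suc (suc (suc r))) (s≤s (s≤s (s≤s _))) n-odd =
  subst UStarHasExactlyOne (sym (T-shifted (suc r))) (OddMiddle.UStar-singleton r c-odd)
  where
  c-odd : ¬ 2 ∣ suc r
  c-odd 2∣c = contradiction (trans (sym n-odd) (n∣m⇒m%n≡0 (suc r) 2 2∣c)) λ ()
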